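{- Let $G=(V,E)$ be a directed graph, $s\neq t$ vertices and $k\ge 5$ an integer, and let $(u,v)$ be an undetermined edge. Then $(u,v)$ is an edge of $SPG_k(s,t)$ if and only if there exists a simple path $q^\ast=\{v_2,v_3,\ldots,v_{l-2}\}$ in $G$ passing through the edge $(u,v)$, of length $l-4\le k-4$, such that (1) $v_2\in D$ and $v_{l-2}\in A$; and (2) there exist $v_1\in In_D(v_2)$ and $v_{l-1}\in Out_A(v_{l-2})$ such that the vertices $s,v_1,v_2,\ldots,v_{l-1},t$ are pairwise distinct.
   Context: A path from $x$ to $y$ is a vertex sequence $x=v_0,\ldots,v_l=y$ with $(v_{i-1},v_i)\in E$; its length is $l$ (length $0$ allowed); $V(p)$ is its vertex set; it is simple if its vertices are pairwise distinct. $P_l^\ast(x,y)$ is the set of simple paths from $x$ to $y$ of length at most $l$. $SPG_k(s,t)$ is the subgraph of $G$ formed by the union of vertices and edges of all simple $s$-$t$ paths of length at most $k$. Essential vertices: $EV_l^\ast(s,u)=\bigcap\{V(p): p\in P_l^\ast(s,u),\ t\notin V(p)\}$ and $EV_l^\ast(v,t)=\bigcap\{V(p): p\in P_l^\ast(v,t),\ s\notin V(p)\}$; $EV_l^\ast(s,u)$ exists iff some $p\in P_l^\ast(s,u)$ has $t\notin V(p)$, and $EV_l^\ast(v,t)$ exists iff some $p\in P_l^\ast(v,t)$ has $s\notin V(p)$. The upper-bound edge set $E^u$ consists of all $(u,v)\in E$ for which there exist nonnegative integers $k_f,k_b$ with $k_f+1+k_b\le k$ such that $EV^\ast_{k_f}(s,u)$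 and $EV^\ast_{k_b}(v,t)$ exist and are disjoint. An edge $(u,v)\in E$ is definite if (a) $u=s$ and $EV^\ast_{k-1}(v,t)$ exists; or (b) $v=t$ and $EV^\ast_{k-1}(s,u)$ exists; or (c) $EV^\ast_1(s,u)$, $EV^\ast_{k-2}(v,t)$ exist and $u\notin EV^\ast_{k-2}(v,t)$; or (d) $EV^\ast_1(v,t)$, $EV^\ast_{k-2}(s,u)$ exist and $v\notin EV^\ast_{k-2}(s,u)$. An undetermined edge is an edge of $E^u$ that is not definite. Departures: $v\in D$ iff there is $x$ with $(x,v)\in E$ such that $x,v,s,t$ are pairwise distinct and $(s,x),(x,v)\in E^u$; for $v\in D$, $In_D(v)$ is the set of all such $x$. Arrivals: $v\in A$ iff there is $y$ with $(v,y)\in E$ such that $v,y,s,t$ are pairwise distinct and $(v,y),(y,t)\in E^u$; for $v\in A$, $Out_A(v)$ is the set of all such $y$. -}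

module Defs where

open import Data.Nat using (ℕ; zero; suc; _+_; _∸_; _≤_)
open import Data.Fin using (Fin)
open import Data.List using (List; []; _∷_; _++_)
open import Data.List.Membership.Propositional using (_∈_; _∉_)
open import Data.List.Relation.Unary.Unique.Propositional using (Unique)
open import Data.Product using (Σ; _×_; ∃; ∃-syntax)
open import Data.Sum using (_⊎_)
open import Data.Empty using (⊥)
open import Relation.Nullary using (¬_)
open import Relation.Binary.PropositionalEquality using (_≡_)

module Graph {n : ℕ} (E : Fin n → Fin n → Set) where

  V : Set
  V = Fin n

  data Path : V → V → Set where
    stop : (x : V) → Path x x
    step : {x y z : V} → E x y → Path y z → Path x z

  verts : {x y : V} → Path x y → List V
  verts (stop x) = x ∷ []
  verts {x} (step _ p) = x ∷ verts p

  len : {x y : V} → Path x y → ℕ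
  len (stop _) = 0
  len (step _ p) = suc (len p)

  Simple : {x y : V} → Path x y → Set
  Simple p = Unique (verts p)

  data UsesEdge (a b : V) : {x y : V} → Path x y → Set where
    here  : {z : V} (e : E a b) (p : Path b z) → UsesEdge a b (step e p)
    there : {x y z : V} (e : E x y) {p : Path y z} → UsesEdge a b p → UsesEdge a b (step e p)

  AvoidingIn : (l : ℕ) (x y w : V) → Path x y → Set
  AvoidingIn l x y w p = Simple p × len p ≤ l × w ∉ verts p

  -- EV*_l(x,y) avoiding w exists (the intersected family is nonempty)
  EVExists : (l : ℕ) (x y w : V) → Set
  EVExists l x y w = Σ (Path x y) (AvoidingIn l x y w)

  -- membership in EV*_l(x,y) (intersection of V(p) over that family)
  InEV : (l : ℕ) (x y w : V) → V → Set
  InEV l x y w z = (p : Path x y) → AvoidingIn l x y w p → z ∈ verts p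

  module ST (s t : V) (k : ℕ) where

    EVfExists : ℕ → V → Set
    EVfExists l u = EVExists l s u t
    InEVf : ℕ → V → V → Set
    InEVf l u = InEV l s u t

    EVbExists : ℕ → V → Set
    EVbExists l v = EVExists l v t s
    InEVb : ℕ → V → V → Set
    InEVb l v = InEV l v t s

    InEu : V → V → Set
    InEu u v = E u v × Σ ℕ λ kf → Σ ℕ λ kb → (kf + 1 + kb ≤ k)
               × EVfExists kf u × EVbExists kb v
               × ((z : V) → InEVf kf u z → InEVb kb v z → ⊥)

    Definite : V → V → Set
    Definite u v = E u v ×
        ( (u ≡ s × EVbExists (k ∸ 1) v)
        ⊎ (v ≡ t × EVfExists (k ∸ 1) u)
        ⊎ (EVfExists 1 u × EVbExists (k ∸ 2) v × ¬ InEVb (k ∸ 2) v u)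
        ⊎ (EVbExists 1 v × EVfExists (k ∸ 2) u × ¬ InEVf (k ∸ 2) u v))

    Undetermined : V → V → Set
    Undetermined u v = InEu u v × ¬ Definite u v

    InD : V → V → Set
    InD v x = E x v × Unique (x ∷ v ∷ s ∷ t ∷ []) × InEu s x × InEu x v

    Departure : V → Set
    Departure v = ∃[ x ] InD v x

    OutA : V → V → Set
    OutA v y = E v y × Unique (v ∷ y ∷ s ∷ t ∷ []) × InEu v y × InEu y t

    Arrival : V → Set
    Arrival v = ∃[ y ] OutA v y

    InSPG : V → V → Set
    InSPG u v = Σ (Path s t) λ p → Simple p × len p ≤ k × UsesEdge u v p

-- A short simple s–t path through an edge that is not definite has at least two edges
-- before it and at least two after it: the four definiteness rules (a)–(d) are witnessed
-- by the prefix and suffix of such a path whenever the edge is at distance at most one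
-- from s or from t. Cutting off the first two and the last two edges leaves q*, and the
-- four removed edges certify the departure and arrival conditions because every edge of
-- a short simple s–t path lies in E^u: its prefix and suffix are vertex-disjoint paths
-- avoiding t and s respectively, so the essential vertex sets they bound are disjoint.
-- Conversely s v₁ q* vₗ₋₁ t is itself a short simple s–t path through (u,v).
module Submission where

open import Defs
open import Level using (Level)
open import Data.Nat using (ℕ; _+_; _∸_; _≤_; suc)
open import Data.Nat.Properties using (+-comm; +-suc; +-assoc; ≤-refl; m+n≤o⇒m≤o∸n)
open import Data.Fin using (Fin)
open import Data.List using (List; []; _∷_; _++_)
open import Data.List.Membership.Propositional using (_∈_)
open import Data.List.Relation.Unary.Any using (here; there)
open import Data.List.Relation.Unary.Unique.Propositional using (Unique)
open import Data.List.Relation.Unary.AllPairs using ([]; _∷_)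
open import Data.List.Relation.Unary.All using ([]; _∷_)
open import Data.List.Relation.Binary.Disjoint.Propositional using (Disjoint)
open import Data.List.Relation.Binary.Sublist.Propositional using (_⊆_; []; _∷_; _∷ʳ_; ⊆-refl; from∈)
open import Data.List.Relation.Binary.Sublist.Propositional.Properties
  using (All-resp-⊆; ++⁺; ++⁺ˡ; ++⁺ʳ)
open import Data.Product using (Σ; _×_; _,_)
open import Data.Sum using (inj₁; inj₂)
open import Data.Empty using (⊥-elim)
open import Relation.Nullary using (¬_)
open import Relation.Binary.PropositionalEquality
  using (_≡_; refl; sym; trans; cong; subst; ≢-sym; module ≡-Reasoning)
open import Function.Bundles using (_⇔_; mk⇔)

module _ {a : Level} {A : Set a} where

  Unique-resp-⊇ : {xs ys : List A} → xs ⊆ ys → Unique ys → Unique xs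
  Unique-resp-⊇ []          []            = []
  Unique-resp-⊇ (_ ∷ʳ xs⊆ys) (_ ∷ ys!)    = Unique-resp-⊇ xs⊆ys ys!
  Unique-resp-⊇ (refl ∷ xs⊆ys) (y∉ ∷ ys!) = All-resp-⊆ xs⊆ys y∉ ∷ Unique-resp-⊇ xs⊆ys ys!

  Unique-++⇒Disjoint : {xs ys : List A} → Unique (xs ++ ys) → Disjoint xs ys
  Unique-++⇒Disjoint xs++ys! (z∈xs , z∈ys)
    with Unique-resp-⊇ (++⁺ (from∈ z∈xs) (from∈ z∈ys)) xs++ys!
  ... | (z≢z ∷ []) ∷ _ = z≢z refl

  Unique-rotate : {w x y z : A} → Unique (w ∷ x ∷ y ∷ z ∷ []) → Unique (x ∷ y ∷ w ∷ z ∷ [])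
  Unique-rotate ((w≢x ∷ w≢y ∷ w≢z ∷ []) ∷ (x≢y ∷ x≢z ∷ []) ∷ (y≢z ∷ []) ∷ [] ∷ []) =
    (x≢y ∷ ≢-sym w≢x ∷ x≢z ∷ []) ∷ (≢-sym w≢y ∷ y≢z ∷ []) ∷ (w≢z ∷ []) ∷ [] ∷ []

module _ {n : ℕ} (E : Fin n → Fin n → Set) where
  open Graph E

  infixr 5 _++ᵖ_
  _++ᵖ_ : {x y z : V} → Path x y → Path y z → Path x z
  stop _   ++ᵖ r = r
  step e p ++ᵖ r = step e (p ++ᵖ r)

  ++ᵖ-assoc : {w x y z : V} (p : Path w x) (q : Path x y) (r : Path y z)
            → (p ++ᵖ q) ++ᵖ r ≡ p ++ᵖ (q ++ᵖ r)
  ++ᵖ-assoc (stop _)   q r = refl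
  ++ᵖ-assoc (step e p) q r = cong (step e) (++ᵖ-assoc p q r)

  len-++ᵖ : {x y z : V} (p : Path x y) (r : Path y z) → len (p ++ᵖ r) ≡ len p + len r
  len-++ᵖ (stop _)   r = refl
  len-++ᵖ (step e p) r = cong suc (len-++ᵖ p r)

  verts-++ᵖ-step : {x a b y : V} (p : Path x a) (e : E a b) (r : Path b y)
                 → verts (p ++ᵖ step e r) ≡ verts p ++ verts r
  verts-++ᵖ-step (stop _)    e r = refl
  verts-++ᵖ-step (step e′ p) e r = cong (_ ∷_) (verts-++ᵖ-step p e r)

  head∈verts : {x y : V} (p : Path x y) → x ∈ verts p
  head∈verts (stop _)   = here refl
  head∈verts (step _ _) = here refl

  last∈verts : {x y : V} (p : Path x y) → y ∈ verts p
  last∈verts (stop _)   = here refl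
  last∈verts (step _ p) = there (last∈verts p)

  UsesEdge-++ᵖˡ : {a b x y z : V} {p : Path x y} (r : Path y z)
                → UsesEdge a b p → UsesEdge a b (p ++ᵖ r)
  UsesEdge-++ᵖˡ r (here e p)    = here e (p ++ᵖ r)
  UsesEdge-++ᵖˡ r (there e uses) = there e (UsesEdge-++ᵖˡ r uses)

  UsesEdge-++ᵖʳ : {a b x y z : V} (p : Path x y) {r : Path y z}
                → UsesEdge a b r → UsesEdge a b (p ++ᵖ r)
  UsesEdge-++ᵖʳ (stop _)   uses = uses
  UsesEdge-++ᵖʳ (step e p) uses = there e (UsesEdge-++ᵖʳ p uses)

  data SplitAt (a b : V) {x y : V} : Path x y → Set where
    split : (pre : Path x a) (e : E a b) (suf : Path b y) → SplitAt a b (pre ++ᵖ step e suf)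

  splitAt : {a b x y : V} {p : Path x y} → UsesEdge a b p → SplitAt a b p
  splitAt (here e p) = split (stop _) e p
  splitAt (there e uses) with splitAt uses
  ... | split pre e′ suf = split (step e pre) e′ suf

  data TailView {x : V} : {y : V} → Path x y → Set where
    edges₀ : TailView (stop x)
    edges₁ : {y : V} (e : E x y) → TailView (step e (stop y))
    edges₂₊ : {y₁ y₂ y : V} (r : Path x y₁) (e₁ : E y₁ y₂) (e₂ : E y₂ y)
            → TailView (r ++ᵖ step e₁ (step e₂ (stop y)))

  tailView : {x y : V} (p : Path x y) → TailView p
  tailView (stop _) = edges₀
  tailView (step e p) with tailView p
  ... | edges₀           = edges₁ e
  ... | edges₁ e′        = edges₂₊ (stop _) e e′
  ... | edges₂₊ r e₁ e₂ = edges₂₊ (step e r) e₁ e₂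

  extend : {w x₁ x y y₁ z : V} → E w x₁ → E x₁ x → Path x y → E y y₁ → E y₁ z → Path w z
  extend e₁ e₂ q e₃ e₄ = step e₁ (step e₂ (q ++ᵖ step e₃ (step e₄ (stop _))))

  module _ {w x₁ x y y₁ z : V} (e₁ : E w x₁) (e₂ : E x₁ x) (q : Path x y) (e₃ : E y y₁) (e₄ : E y₁ z) where

    verts-extend : verts (extend e₁ e₂ q e₃ e₄) ≡ w ∷ x₁ ∷ verts q ++ y₁ ∷ z ∷ []
    verts-extend = cong (λ vs → w ∷ x₁ ∷ vs) (verts-++ᵖ-step q e₃ (step e₄ (stop z)))

    len-extend : len (extend e₁ e₂ q e₃ e₄) ≡ len q + 4
    len-extend = begin
      2 + len (q ++ᵖ step e₃ (step e₄ (stop z))) ≡⟨ cong (2 +_) (len-++ᵖ q _) ⟩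
      2 + (len q + 2)                             ≡⟨ cong (2 +_) (+-comm (len q) 2) ⟩
      4 + len q                                   ≡⟨ +-comm 4 (len q) ⟩
      len q + 4                                   ∎
      where open ≡-Reasoning

  module _ {x a b y : V} (pre : Path x a) (e : E a b) (suf : Path b y) where

    prefix-len-≤ : {l : ℕ} → len (pre ++ᵖ step e suf) ≤ l → len pre ≤ l ∸ suc (len suf)
    prefix-len-≤ {l} short = m+n≤o⇒m≤o∸n (len pre) (subst (_≤ l) (len-++ᵖ pre _) short)

    suffix-len-≤ : {l : ℕ} → len (pre ++ᵖ step e suf) ≤ l → len suf ≤ l ∸ suc (len pre)
    suffix-len-≤ {l} short = m+n≤o⇒m≤o∸n (len suf) (subst (_≤ l) swap short)
      where
      swap : len (pre ++ᵖ step e suf) ≡ len suf + suc (len pre)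
      swap = trans (len-++ᵖ pre _) (trans (+-suc (len pre) (len suf)) (sym (+-comm (len suf) (suc (len pre)))))

    module _ (simple : Simple (pre ++ᵖ step e suf)) where

      private
        pre++suf! : Unique (verts pre ++ verts suf)
        pre++suf! = subst Unique (verts-++ᵖ-step pre e suf) simple

      prefix-suffix-disjoint : Disjoint (verts pre) (verts suf)
      prefix-suffix-disjoint = Unique-++⇒Disjoint pre++suf!

      prefix-avoiding : {l : ℕ} → len pre ≤ l → AvoidingIn l x a y pre
      prefix-avoiding bound =
        Unique-resp-⊇ (++⁺ʳ (verts suf) ⊆-refl) pre++suf! , bound ,
        λ y∈pre → prefix-suffix-disjoint (y∈pre , last∈verts suf)

      suffix-avoiding : {l : ℕ} → len suf ≤ l → AvoidingIn l b y x suf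
      suffix-avoiding bound =
        Unique-resp-⊇ (++⁺ˡ (verts pre) ⊆-refl) pre++suf! , bound ,
        λ x∈suf → prefix-suffix-disjoint (head∈verts pre , x∈suf)

  module _ (s t : V) (k : ℕ) where
    open ST s t k

    SPG⇒Eu : {a b : V} → InSPG a b → InEu a b
    SPG⇒Eu (p , simple , short , uses) with splitAt uses
    ... | split pre e suf =
      e , len pre , len suf , bound , (pre , pre-avoids) , (suf , suf-avoids) ,
      λ z z∈EVf z∈EVb → prefix-suffix-disjoint pre e suf simple
                           (z∈EVf pre pre-avoids , z∈EVb suf suf-avoids)
      where
      pre-avoids = prefix-avoiding pre e suf simple ≤-refl
      suf-avoids = suffix-avoiding pre e suf simple ≤-refl
      bound : len pre + 1 + len suf ≤ k
      bound = subst (_≤ k) (trans (len-++ᵖ pre _) (sym (+-assoc (len pre) 1 (len suf)))) short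

    first-edge-definite : {b : V} (e : E s b) (suf : Path b t)
                        → Simple (step e suf) → len (step e suf) ≤ k → Definite s b
    first-edge-definite e suf simple short =
      e , inj₁ (refl , suf , suffix-avoiding (stop s) e suf simple (suffix-len-≤ (stop s) e suf short))

    last-edge-definite : {a : V} (pre : Path s a) (e : E a t)
                       → Simple (pre ++ᵖ step e (stop t)) → len (pre ++ᵖ step e (stop t)) ≤ k
                       → Definite a t
    last-edge-definite pre e simple short =
      e , inj₂ (inj₁ (refl , pre , prefix-avoiding pre e (stop t) simple (prefix-len-≤ pre e (stop t) short)))

    second-edge-definite : {a b : V} (e₁ : E s a) (e : E a b) (suf : Path b t)
                         → Simple (step e₁ (step e suf)) → len (step e₁ (step e suf)) ≤ k
                         → Definite a b
    second-edge-definite {a} e₁ e suf simple short =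
      e , inj₂ (inj₂ (inj₁ ((pre , prefix-avoiding pre e suf simple ≤-refl) , (suf , suf-avoids) ,
                            λ a∈EVb → prefix-suffix-disjoint pre e suf simple
                                         (last∈verts pre , a∈EVb suf suf-avoids))))
      where
      pre = step e₁ (stop a)
      suf-avoids = suffix-avoiding pre e suf simple (suffix-len-≤ pre e suf short)

    penultimate-edge-definite : {a b : V} (pre : Path s a) (e : E a b) (e₄ : E b t)
                              → Simple (pre ++ᵖ step e (step e₄ (stop t)))
                              → len (pre ++ᵖ step e (step e₄ (stop t))) ≤ k
                              → Definite a b
    penultimate-edge-definite pre e e₄ simple short =
      e , inj₂ (inj₂ (inj₂ ((suf , suffix-avoiding pre e suf simple ≤-refl) , (pre , pre-avoids) ,
                            λ b∈EVf → prefix-suffix-disjoint pre e suf simple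
                                         (b∈EVf pre pre-avoids , head∈verts suf))))
      where
      suf = step e₄ (stop t)
      pre-avoids = prefix-avoiding pre e suf simple (prefix-len-≤ pre e suf short)

    DepartureArrivalPath : V → V → Set
    DepartureArrivalPath u v =
      Σ V λ v₂ → Σ V λ vl₂ → Σ (Path v₂ vl₂) λ q →
        Simple q × UsesEdge u v q × len q + 4 ≤ k
        × Departure v₂ × Arrival vl₂
        × Σ V λ v₁ → Σ V λ vl₁ →
            InD v₂ v₁ × OutA vl₂ vl₁
            × Unique (s ∷ v₁ ∷ (verts q ++ (vl₁ ∷ t ∷ [])))

    DepartureArrival⇒SPG : {u v : V} → DepartureArrivalPath u v → InSPG u v
    DepartureArrival⇒SPG (_ , _ , q , _ , uses , short , _ , _ , _ , _ ,
                          (e₂ , _ , (e₁ , _) , _) , (e₃ , _ , _ , (e₄ , _)) , distinct) =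
      extend e₁ e₂ q e₃ e₄ ,
      subst Unique (sym (verts-extend e₁ e₂ q e₃ e₄)) distinct ,
      subst (_≤ k) (sym (len-extend e₁ e₂ q e₃ e₄)) short ,
      there e₁ (there e₂ (UsesEdge-++ᵖˡ _ uses))

    extend⇒DepartureArrival : {u v v₁ v₂ vl₂ vl₁ : V}
      (e₁ : E s v₁) (e₂ : E v₁ v₂) (q : Path v₂ vl₂) (e₃ : E vl₂ vl₁) (e₄ : E vl₁ t)
      → Simple (extend e₁ e₂ q e₃ e₄) → len (extend e₁ e₂ q e₃ e₄) ≤ k → UsesEdge u v q
      → DepartureArrivalPath u v
    extend⇒DepartureArrival {v₁ = v₁} {v₂} {vl₂} {vl₁} e₁ e₂ q e₃ e₄ simple short uses =
      v₂ , vl₂ , q , Unique-resp-⊇ (s ∷ʳ v₁ ∷ʳ ++⁺ʳ _ ⊆-refl) distinct ,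
      uses , subst (_≤ k) (len-extend e₁ e₂ q e₃ e₄) short ,
      (v₁ , departure) , (vl₁ , arrival) , v₁ , vl₁ , departure , arrival , distinct
      where
      distinct : Unique (s ∷ v₁ ∷ verts q ++ vl₁ ∷ t ∷ [])
      distinct = subst Unique (verts-extend e₁ e₂ q e₃ e₄) simple
      edge∈Eu : {a b : V} → UsesEdge a b (extend e₁ e₂ q e₃ e₄) → InEu a b
      edge∈Eu uses′ = SPG⇒Eu (extend e₁ e₂ q e₃ e₄ , simple , short , uses′)
      departure : InD v₂ v₁
      departure =
        e₂ ,
        Unique-rotate (Unique-resp-⊇ (refl ∷ refl ∷ ++⁺ (from∈ (head∈verts q)) (vl₁ ∷ʳ ⊆-refl)) distinct) ,
        edge∈Eu (here e₁ _) , edge∈Eu (there e₁ (here e₂ _))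
      arrival : OutA vl₂ vl₁
      arrival =
        e₃ ,
        Unique-rotate (Unique-resp-⊇ (refl ∷ v₁ ∷ʳ ++⁺ (from∈ (last∈verts q)) ⊆-refl) distinct) ,
        edge∈Eu (there e₁ (there e₂ (UsesEdge-++ᵖʳ q (here e₃ _)))) ,
        edge∈Eu (there e₁ (there e₂ (UsesEdge-++ᵖʳ q (there e₃ (here e₄ _)))))

    split⇒DepartureArrival : {u v : V} → ¬ Definite u v
      → (pre : Path s u) (e : E u v) (suf : Path v t)
      → Simple (pre ++ᵖ step e suf) → len (pre ++ᵖ step e suf) ≤ k
      → DepartureArrivalPath u v
    split⇒DepartureArrival not-definite (stop _) e suf simple short =
      ⊥-elim (not-definite (first-edge-definite e suf simple short))
    split⇒DepartureArrival not-definite (step e₁ (stop _)) e suf simple short =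
      ⊥-elim (not-definite (second-edge-definite e₁ e suf simple short))
    split⇒DepartureArrival not-definite pre@(step e₁ (step e₂ pre′)) e suf simple short
      with tailView suf
    ... | edges₀ = ⊥-elim (not-definite (last-edge-definite pre e simple short))
    ... | edges₁ e₄ = ⊥-elim (not-definite (penultimate-edge-definite pre e e₄ simple short))
    ... | edges₂₊ r e₃ e₄ =
      extend⇒DepartureArrival e₁ e₂ (pre′ ++ᵖ step e r) e₃ e₄
        (subst Simple (sym reassociate) simple) (subst (λ p → len p ≤ k) (sym reassociate) short)
        (UsesEdge-++ᵖʳ pre′ (here e r))
      where
      reassociate : extend e₁ e₂ (pre′ ++ᵖ step e r) e₃ e₄ ≡ pre ++ᵖ step e (r ++ᵖ step e₃ (step e₄ (stop t)))
      reassociate = cong (λ p → step e₁ (step e₂ p)) (++ᵖ-assoc pre′ (step e r) _)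

    SPG⇒DepartureArrival : {u v : V} → ¬ Definite u v → InSPG u v → DepartureArrivalPath u v
    SPG⇒DepartureArrival not-definite (p , simple , short , uses) with splitAt uses
    ... | split pre e suf = split⇒DepartureArrival not-definite pre e suf simple short

theorem10 : {n : ℕ} (E : Fin n → Fin n → Set) (s t : Fin n) (k : ℕ)
    → ¬ (s ≡ t) → 5 ≤ k → (u v : Fin n)
    → Graph.ST.Undetermined E s t k u v
    → Graph.ST.InSPG E s t k u v
    ⇔ Σ (Fin n) λ v₂ → Σ (Fin n) λ vl₂ → Σ (Graph.Path E v₂ vl₂) λ q →
    Graph.Simple E q × Graph.UsesEdge E u v q × Graph.len E q + 4 ≤ k
    × Graph.ST.Departure E s t k v₂ × Graph.ST.Arrival E s t k vl₂
    × Σ (Fin n) λ v₁ → Σ (Fin n) λ vl₁ →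
    Graph.ST.InD E s t k v₂ v₁ × Graph.ST.OutA E s t k vl₂ vl₁
    × Unique (s ∷ v₁ ∷ (Graph.verts E q ++ (vl₁ ∷ t ∷ [])))
theorem10 E s t k _ _ u v (_ , not-definite) =
  mk⇔ (SPG⇒DepartureArrival E s t k not-definite) (DepartureArrival⇒SPG E s t k)
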